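{- Let $n\ge 0$ and $m$ be integers with $0<m\le 2^n$. Then the pattern $R_{m,m}$ is similar to the section $H_{n,m}$ (identifying the plane $\{z=1-m/2^n\}$ with $\mathbb{R}^2$), i.e. there is a similarity transformation of the plane mapping one onto the other.
   Context: Chocolate game: for a positive integer $m$, $C_{m,m}$ is a two-player impartial game on an $m\times m$ chocolate bar of unit cells, one of which is poisoned (known to both players); cells are $(i,j)\in\mathbb{Z}^2$, $1\le i,j\le m$. Players alternately break the current bar along a grid line into two rectangles, eat one and pass the other (always keeping the poisoned cell); a player who receives the $1\times 1$ bar loses. A cell is a P-position if with poison there the second player has a winning strategy; $P_{m,m}$ is the set of P-positions. It is known that $(i,j)\in P_{m,m}$ iff $(i-1)\oplus(j-1)\oplus(m-i)\oplus(m-j)=0$ ($\oplus$ = bitwise XOR). The pattern is $R_{m,m}=\{(i-x,j-y)\in\mathbb{R}^2: 0\le x,y\le 1,\ (i,j)\in P_{m,m}\}$. Sierpiński octahedron: the operation $T$ on a regular octahedron with center $O$ removes, for each of its eight faces, the tetrahedron spanned by $O$ and the three midpoints of the edges of that face; what remains is six regular octahedra of half the edge length (one at each vertex). Let $S_0$ be the regular octahedron with vertices $(\pm1,0,0),(0,\pm1,0),(0,0,\pm1)$, and let $S_{n}$ be obtained by applying $T$ to each of the octahedra of $S_{n-1}$; thus $S_n$ is a union of $6^n$ regular octahedra of edge length $\sqrt2/2^n$. For an integer $m$, $H_{n,m}=S_n\cap\{z=1-m/2^n\}$.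
   Formalization: Points of space and of the plane, hence of $S_n$, $H_{n,m}$ and $R_{m,m}$, have rational coordinates, and the similarity transformation is taken with rational coefficients. -}

module Defs where

open import Data.Nat as ℕ using (ℕ; zero; suc)
open import Data.Nat.DivMod using (_/_; _%_)
open import Data.Integer using (+_)
open import Data.Rational as ℚ using (ℚ; 0ℚ; 1ℚ; ½; _+_; _-_; _*_; -_; ∣_∣; _≤_)
open import Data.Bool using (Bool; true; false)
open import Data.List using (List; []; _∷_; concatMap)
open import Data.List.Relation.Unary.Any using (Any)
open import Data.Product using (_×_; _,_; ∃; ∃-syntax)
open import Relation.Binary.PropositionalEquality using (_≡_)
open import Relation.Nullary using (¬_)

-- Bitwise XOR on ℕ (the stdlib has none).  xorF k a b computes the XOR of
-- the k lowest bits; with fuel a + b (≥ bit length of a and b) it is the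
-- full XOR.

xorF : ℕ → ℕ → ℕ → ℕ
xorF zero      a b = 0
xorF (suc k) a b = ((a % 2) ℕ.+ (b % 2)) % 2 ℕ.+ 2 ℕ.* xorF k (a / 2) (b / 2)

_⊕_ : ℕ → ℕ → ℕ
a ⊕ b = xorF (a ℕ.+ b) a b

infixl 6 _⊕_

IsP : ℕ → ℕ → ℕ → Set
IsP m i j = (i ℕ.∸ 1) ⊕ (j ℕ.∸ 1) ⊕ (m ℕ.∸ i) ⊕ (m ℕ.∸ j) ≡ 0

InP : ℕ → ℕ → ℕ → Set
InP m i j = (1 ℕ.≤ i) × (i ℕ.≤ m) × (1 ℕ.≤ j) × (j ℕ.≤ m) × IsP m i j

ℕ→ℚ : ℕ → ℚ
ℕ→ℚ k = (+ k) ℚ./ 1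

Point2 : Set
Point2 = ℚ × ℚ

InR : ℕ → Point2 → Set
InR m (u , v) = ∃[ i ] ∃[ j ] InP m i j
  × (ℕ→ℚ i - 1ℚ ≤ u) × (u ≤ ℕ→ℚ i)
  × (ℕ→ℚ j - 1ℚ ≤ v) × (v ≤ ℕ→ℚ j)

-- Sierpiński octahedron.  A regular octahedron with axis-parallel
-- diagonals is described by its centre c and radius r (half-diagonal):
-- { p : |p₁-c₁| + |p₂-c₂| + |p₃-c₃| ≤ r }, edge length r√2.

Point3 : Set
Point3 = ℚ × ℚ × ℚ

record Oct : Set where
  constructor oct
  field
    centre : Point3
    radius : ℚ

InOct : Oct → Point3 → Set
InOct (oct (a , b , c) r) (x , y , z) = ∣ x - a ∣ + ∣ y - b ∣ + ∣ z - c ∣ ≤ r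

-- The operation T: the six octahedra of half size at the six vertices
-- c ± r eₖ (centres c ± (r/2) eₖ, radius r/2).
T : Oct → List Oct
T (oct (a , b , c) r) =
    oct (a + h , b , c) h ∷ oct (a - h , b , c) h
  ∷ oct (a , b + h , c) h ∷ oct (a , b - h , c) h
  ∷ oct (a , b , c + h) h ∷ oct (a , b , c - h) h ∷ []
  where h = ½ * r

S : ℕ → List Oct
S zero    = oct (0ℚ , 0ℚ , 0ℚ) 1ℚ ∷ []
S (suc n) = concatMap T (S n)

InS : ℕ → Point3 → Set
InS n p = Any (λ o → InOct o p) (S n)

halfPow : ℕ → ℚ
halfPow zero    = 1ℚ
halfPow (suc n) = ½ * halfPow n

InH : ℕ → ℕ → Point2 → Set
InH n m (x , y) = InS n (x , y , 1ℚ - ℕ→ℚ m * halfPow n)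

-- Similarity transformations of the plane (with rational coefficients):
-- (x , y) ↦ (a x - s b y + c , b x + s a y + d), s = ±1, (a , b) ≠ (0 , 0).
-- s = +1: rotation-dilation, s = -1: reflection-dilation.

record Similarity : Set where
  field
    a b c d : ℚ
    orient  : Bool
    nondeg  : ¬ (a ≡ 0ℚ × b ≡ 0ℚ)

sgn : Bool → ℚ
sgn true  = 1ℚ
sgn false = - 1ℚ

apply : Similarity → Point2 → Point2
apply f (x , y) =
  (a * x - s * b * y + c) , (b * x + s * a * y + d)
  where
    open Similarity f
    s = sgn orient

-- f maps the set A onto the set B (f is a bijection of the plane)
MapsOnto : Similarity → (Point2 → Set) → (Point2 → Set) → Set
MapsOnto f A B = ∀ p → (A p → B (apply f p)) × (B (apply f p) → A p)

module Submission where

-- The 6ⁿ octahedra of S_n are addressed by quadruples (a, b, c, d) of naturals: refining an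
-- octahedron at one of its six vertices appends the binary digits of that vertex to
-- (a, b, c, d) as new lowest digits.  The octahedron of (a, b, c, d) has radius 2⁻ⁿ and its
-- centre at height 1 - (1 + a + b)/2ⁿ, on level 1 + a + b.  By induction on the binary
-- digits, the addresses are exactly the quadruples with a + b = c + d < 2ⁿ and
-- a ⊕ c ⊕ b ⊕ d = 0: the six digit vectors are the only lowest digits compatible with both
-- conditions, as any other one either makes the XOR odd or forces a carry that makes it odd
-- one digit higher.  For m = 1 + a + b, i = 1 + a and j = 1 + c this says (i, j) ∈ P_{m,m}.
-- The plane of level m cuts each octahedron of level m in the image of the cell (i, j) under
-- the similarity (u, v) ↦ 2⁻ⁿ (u + v - m, u - v); it meets an octahedron of level m ± 1 in a
-- single vertex, which is a horizontal vertex of an octahedron of level m; and it misses all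
-- the other octahedra.

open import Defs

module Binary where
  open import Data.Nat using (ℕ; zero; suc; _+_; _*_; _≤_; _<_; z≤n; s≤s)
  open import Data.Nat.DivMod
  open import Data.Nat.Divisibility using (divides-refl)
  open import Data.Nat.Properties
  open import Relation.Binary.PropositionalEquality

  data Bit : Set where
    b₀ b₁ : Bit

  bit : Bit → ℕ
  bit b₀ = 0
  bit b₁ = 1

  bit<2 : ∀ x → bit x < 2
  bit<2 b₀ = s≤s z≤n
  bit<2 b₁ = s≤s (s≤s z≤n)

  infixr 5 _∷ᵇ_ _∷_

  _∷ᵇ_ : Bit → ℕ → ℕ
  x ∷ᵇ k = bit x + 2 * k

  data Binary : ℕ → Set where
    _∷_ : ∀ x k → Binary (x ∷ᵇ k)

  binary : ∀ n → Binary n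
  binary zero = b₀ ∷ 0
  binary (suc n) with binary n
  ... | b₀ ∷ k = b₁ ∷ k
  ... | b₁ ∷ k = subst Binary (*-suc 2 k) (b₀ ∷ suc k)

  [m+2k]%2≡m%2 : ∀ m k → (m + 2 * k) % 2 ≡ m % 2
  [m+2k]%2≡m%2 m k = trans (cong (λ t → (m + t) % 2) (*-comm 2 k)) ([m+kn]%n≡m%n m k 2)

  digit-mod : ∀ {x} k → x < 2 → (x + 2 * k) % 2 ≡ x
  digit-mod {x} k x<2 = trans ([m+2k]%2≡m%2 x k) (m<n⇒m%n≡m x<2)

  digit-div : ∀ {x} k → x < 2 → (x + 2 * k) / 2 ≡ k
  digit-div {x} k x<2 = begin
    (x + 2 * k) / 2    ≡⟨ cong (λ t → (x + t) / 2) (*-comm 2 k) ⟩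
    (x + k * 2) / 2    ≡⟨ +-distrib-/-∣ʳ x (divides-refl k) ⟩
    x / 2 + k * 2 / 2  ≡⟨ cong₂ _+_ (m<n⇒m/n≡0 x<2) (m*n/n≡m k 2) ⟩
    k                  ∎
    where open ≡-Reasoning

  %2-absorbˡ : ∀ m n → (m % 2 + n) % 2 ≡ (m + n) % 2
  %2-absorbˡ m n = begin
    (m % 2 + n) % 2          ≡⟨ %-distribˡ-+ (m % 2) n 2 ⟩
    (m % 2 % 2 + n % 2) % 2  ≡⟨ cong (λ t → (t + n % 2) % 2) (m%n%n≡m%n m 2) ⟩
    (m % 2 + n % 2) % 2      ≡⟨ %-distribˡ-+ m n 2 ⟨
    (m + n) % 2              ∎
    where open ≡-Reasoning

  %2-congˡ : ∀ m n k → m % 2 ≡ n % 2 → (m + k) % 2 ≡ (n + k) % 2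
  %2-congˡ m n k m≡n = begin
    (m + k) % 2      ≡⟨ %2-absorbˡ m k ⟨
    (m % 2 + k) % 2  ≡⟨ cong (λ t → (t + k) % 2) m≡n ⟩
    (n % 2 + k) % 2  ≡⟨ %2-absorbˡ n k ⟩
    (n + k) % 2      ∎
    where open ≡-Reasoning

  xorF-0-0 : ∀ k → xorF k 0 0 ≡ 0
  xorF-0-0 zero    = refl
  xorF-0-0 (suc k) = cong (2 *_) (xorF-0-0 k)

  halves-sum-≤ : ∀ a b {k} → a + b ≤ suc k → a / 2 + b / 2 ≤ k
  halves-sum-≤ a b {k} a+b≤1+k = halve (begin
    (a / 2 + b / 2) * 2    ≡⟨ *-distribʳ-+ 2 (a / 2) (b / 2) ⟩
    a / 2 * 2 + b / 2 * 2  ≤⟨ +-mono-≤ (m/n*n≤m a 2) (m/n*n≤m b 2) ⟩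
    a + b                  ≤⟨ a+b≤1+k ⟩
    suc k                  ∎)
    where
    open ≤-Reasoning
    halve : ∀ {s} → s * 2 ≤ suc k → s ≤ k
    halve {zero}  _            = z≤n
    halve {suc s} (s≤s 2s+1≤k) = ≤-trans (s≤s (m≤m*n s 2)) 2s+1≤k

  -- a + b bounds the bit length of a and b, so it is already enough fuel.
  xorF-fuel : ∀ {k l} a b → a + b ≤ k → a + b ≤ l → xorF k a b ≡ xorF l a b
  xorF-fuel {zero}  {l}     zero    zero    _ _ = sym (xorF-0-0 l)
  xorF-fuel {suc k} {zero}  zero    zero    _ _ = xorF-0-0 (suc k)
  xorF-fuel {suc k} {suc l} a       b       p q = cong (λ r → (a % 2 + b % 2) % 2 + 2 * r)
    (xorF-fuel (a / 2) (b / 2) (halves-sum-≤ a b p) (halves-sum-≤ a b q))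
  xorF-fuel {zero}  {_}     (suc a) _       () _
  xorF-fuel {zero}  {_}     zero    (suc b) () _
  xorF-fuel {suc k} {zero}  (suc a) _       _ ()
  xorF-fuel {suc k} {zero}  zero    (suc b) _ ()

  ⊕-unfold : ∀ a b → a ⊕ b ≡ (a % 2 + b % 2) % 2 + 2 * (a / 2 ⊕ b / 2)
  ⊕-unfold a b = trans (xorF-fuel a b ≤-refl (n≤1+n (a + b)))
    (cong (λ r → (a % 2 + b % 2) % 2 + 2 * r)
          (xorF-fuel (a / 2) (b / 2) (+-mono-≤ (m/n≤m a 2) (m/n≤m b 2)) ≤-refl))

  ⊕-digits : ∀ {x y} p q → x < 2 → y < 2 → (x + 2 * p) ⊕ (y + 2 * q) ≡ (x + y) % 2 + 2 * (p ⊕ q)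
  ⊕-digits {x} {y} p q x<2 y<2 = trans (⊕-unfold (x + 2 * p) (y + 2 * q))
    (cong₂ (λ s r → s + 2 * r) (cong₂ (λ s t → (s + t) % 2) (digit-mod p x<2) (digit-mod q y<2))
                               (cong₂ _⊕_ (digit-div p x<2) (digit-div q y<2)))

  ⊕-digits-%2 : ∀ {y} s p q → y < 2 → (s % 2 + 2 * p) ⊕ (y + 2 * q) ≡ (s + y) % 2 + 2 * (p ⊕ q)
  ⊕-digits-%2 {y} s p q y<2 = trans (⊕-digits p q (m%n<n s 2) y<2)
    (cong (λ t → t + 2 * (p ⊕ q)) (%2-absorbˡ s y))

  ⊕-parity : ∀ a b → (a ⊕ b) % 2 ≡ (a + b) % 2
  ⊕-parity a b = begin
    (a ⊕ b) % 2                                      ≡⟨ cong (_% 2) (⊕-unfold a b) ⟩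
    ((a % 2 + b % 2) % 2 + 2 * (a / 2 ⊕ b / 2)) % 2  ≡⟨ [m+2k]%2≡m%2 ((a % 2 + b % 2) % 2) (a / 2 ⊕ b / 2) ⟩
    (a % 2 + b % 2) % 2 % 2                          ≡⟨ m%n%n≡m%n (a % 2 + b % 2) 2 ⟩
    (a % 2 + b % 2) % 2                              ≡⟨ %-distribˡ-+ a b 2 ⟨
    (a + b) % 2                                      ∎
    where open ≡-Reasoning

module Quads where
  open Binary
  open import Data.Nat using (ℕ; suc; _+_; _*_; _^_; _<_; z≤n; s≤s)
  open import Data.Nat.DivMod using (_%_)
  open import Data.Nat.Properties
  open import Data.Nat.Tactic.RingSolver using (solve-∀)
  open import Data.Product using (_×_; _,_)
  open import Data.Sum using (_⊎_; inj₁; inj₂)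
  open import Relation.Binary.PropositionalEquality

  -- (a, b, c, d) stands for (i - 1, m - i, j - 1, m - j): the cell (i, j) of the m × m board
  -- with m = 1 + a + b, so that xor is the P-position test of the chocolate game.
  Quad : Set
  Quad = ℕ × ℕ × ℕ × ℕ

  level : Quad → ℕ
  level (a , b , _ , _) = a + b

  Balanced : Quad → Set
  Balanced (a , b , c , d) = a + b ≡ c + d

  xor : Quad → ℕ
  xor (a , b , c , d) = a ⊕ c ⊕ b ⊕ d

  sum : Quad → ℕ
  sum (a , b , c , d) = a + c + b + d

  Bit⁴ : Set
  Bit⁴ = Bit × Bit × Bit × Bit

  bits : Bit⁴ → Quad
  bits (x , y , z , w) = bit x , bit y , bit z , bit w

  infixr 5 _∷⁴_

  _∷⁴_ : Bit⁴ → Quad → Quad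
  (x , y , z , w) ∷⁴ (a , b , c , d) = x ∷ᵇ a , y ∷ᵇ b , z ∷ᵇ c , w ∷ᵇ d

  xor-∷⁴ : ∀ x q → xor (x ∷⁴ q) ≡ sum (bits x) % 2 + 2 * xor q
  xor-∷⁴ (x , y , z , w) (a , b , c , d) = begin
    (x ∷ᵇ a) ⊕ (z ∷ᵇ c) ⊕ (y ∷ᵇ b) ⊕ (w ∷ᵇ d)
      ≡⟨ cong (λ t → t ⊕ (y ∷ᵇ b) ⊕ (w ∷ᵇ d)) (⊕-digits a c (bit<2 x) (bit<2 z)) ⟩
    ((bit x + bit z) % 2 + 2 * (a ⊕ c)) ⊕ (y ∷ᵇ b) ⊕ (w ∷ᵇ d)
      ≡⟨ cong (_⊕ (w ∷ᵇ d)) (⊕-digits-%2 (bit x + bit z) (a ⊕ c) b (bit<2 y)) ⟩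
    ((bit x + bit z + bit y) % 2 + 2 * (a ⊕ c ⊕ b)) ⊕ (w ∷ᵇ d)
      ≡⟨ ⊕-digits-%2 (bit x + bit z + bit y) (a ⊕ c ⊕ b) d (bit<2 w) ⟩
    (bit x + bit z + bit y + bit w) % 2 + 2 * (a ⊕ c ⊕ b ⊕ d)
      ∎
    where open ≡-Reasoning

  xor-parity : ∀ q → xor q % 2 ≡ sum q % 2
  xor-parity (a , b , c , d) = trans (⊕-parity (a ⊕ c ⊕ b) d) (%2-congˡ (a ⊕ c ⊕ b) (a + c + b) d
    (trans (⊕-parity (a ⊕ c) b) (%2-congˡ (a ⊕ c) (a + c) b (⊕-parity a c))))

  +-digitwise : ∀ x y a b → (x + 2 * a) + (y + 2 * b) ≡ (x + y) + 2 * (a + b)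
  +-digitwise = solve-∀

  level-∷⁴ : ∀ x q → level (x ∷⁴ q) ≡ level (bits x) + 2 * level q
  level-∷⁴ (x , y , _ , _) (a , b , _ , _) = +-digitwise (bit x) (bit y) a b

  balanced-∷⁴ : ∀ x q → Balanced (bits x) → Balanced q → Balanced (x ∷⁴ q)
  balanced-∷⁴ (x , y , z , w) (a , b , c , d) low high = begin
    (x ∷ᵇ a) + (y ∷ᵇ b)          ≡⟨ +-digitwise (bit x) (bit y) a b ⟩
    bit x + bit y + 2 * (a + b)  ≡⟨ cong₂ (λ s t → s + 2 * t) low high ⟩
    bit z + bit w + 2 * (c + d)  ≡⟨ +-digitwise (bit z) (bit w) c d ⟨
    (z ∷ᵇ c) + (w ∷ᵇ d)          ∎
    where open ≡-Reasoning

  balanced-halves : ∀ x q → Balanced (bits x) → Balanced (x ∷⁴ q) → Balanced q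
  balanced-halves (x , y , z , w) (a , b , c , d) low balanced =
    *-cancelˡ-≡ (a + b) (c + d) 2 (+-cancelˡ-≡ (bit x + bit y) _ _ (begin
      bit x + bit y + 2 * (a + b)  ≡⟨ +-digitwise (bit x) (bit y) a b ⟨
      (x ∷ᵇ a) + (y ∷ᵇ b)          ≡⟨ balanced ⟩
      (z ∷ᵇ c) + (w ∷ᵇ d)          ≡⟨ +-digitwise (bit z) (bit w) c d ⟩
      bit z + bit w + 2 * (c + d)  ≡⟨ cong (_+ 2 * (c + d)) low ⟨
      bit x + bit y + 2 * (c + d)  ∎))
    where open ≡-Reasoning

  xor-halves : ∀ x q → xor (x ∷⁴ q) ≡ 0 → sum (bits x) % 2 ≡ 0 × xor q ≡ 0
  xor-halves x q xor≡0 =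
    m+n≡0⇒m≡0 (sum (bits x) % 2) low+2high≡0 ,
    *-cancelˡ-≡ (xor q) 0 2 (m+n≡0⇒n≡0 (sum (bits x) % 2) low+2high≡0)
    where low+2high≡0 = trans (sym (xor-∷⁴ x q)) xor≡0

  level-halves : ∀ x q n → level (x ∷⁴ q) < 2 ^ suc n → level q < 2 ^ n
  level-halves x q n bound = *-cancelˡ-< 2 (level q) (2 ^ n) (begin-strict
    2 * level q                   ≤⟨ m≤n+m (2 * level q) (level (bits x)) ⟩
    level (bits x) + 2 * level q  ≡⟨ level-∷⁴ x q ⟨
    level (x ∷⁴ q)                <⟨ bound ⟩
    2 ^ suc n                     ∎)
    where open ≤-Reasoning

  balanced-carry : ∀ a b c d → (b₀ ∷ᵇ a) + (b₀ ∷ᵇ b) ≡ (b₁ ∷ᵇ c) + (b₁ ∷ᵇ d) → a + b ≡ suc (c + d)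
  balanced-carry a b c d balanced = *-cancelˡ-≡ (a + b) (suc (c + d)) 2 (begin
    2 * (a + b)            ≡⟨ +-digitwise 0 0 a b ⟨
    (b₀ ∷ᵇ a) + (b₀ ∷ᵇ b)  ≡⟨ balanced ⟩
    (b₁ ∷ᵇ c) + (b₁ ∷ᵇ d)  ≡⟨ +-digitwise 1 1 c d ⟩
    2 + 2 * (c + d)        ≡⟨ *-suc 2 (c + d) ⟨
    2 * suc (c + d)        ∎)
    where open ≡-Reasoning

  [1+k+k]%2≡1 : ∀ k → (suc k + k) % 2 ≡ 1
  [1+k+k]%2≡1 k = trans (cong (_% 2) (1+k+k≡1+2k k)) (digit-mod k (s≤s (s≤s z≤n)))
    where
    1+k+k≡1+2k : ∀ k → suc k + k ≡ 1 + 2 * k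
    1+k+k≡1+2k = solve-∀

  carry-impossible : ∀ a b c d → a + b ≡ suc (c + d) ⊎ c + d ≡ suc (a + b) → xor (a , b , c , d) ≢ 0
  carry-impossible a b c d carry xor≡0 = 1+n≢0 (begin
    1                      ≡⟨ odd-total carry ⟨
    (a + b + (c + d)) % 2  ≡⟨ cong (_% 2) (interchange a b c d) ⟩
    (a + c + b + d) % 2    ≡⟨ xor-parity (a , b , c , d) ⟨
    (a ⊕ c ⊕ b ⊕ d) % 2    ≡⟨ cong (_% 2) xor≡0 ⟩
    0                      ∎)
    where
    open ≡-Reasoning
    interchange : ∀ a b c d → a + b + (c + d) ≡ a + c + b + d
    interchange = solve-∀
    odd-total : a + b ≡ suc (c + d) ⊎ c + d ≡ suc (a + b) → (a + b + (c + d)) % 2 ≡ 1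
    odd-total (inj₁ eq) rewrite eq = [1+k+k]%2≡1 (c + d)
    odd-total (inj₂ eq) rewrite eq = trans (cong (_% 2) (+-comm (a + b) _)) ([1+k+k]%2≡1 (a + b))

module Addresses where
  open Binary
  open Quads
  open import Data.Nat using (ℕ; zero; suc; _+_; _*_; _∸_; _^_; _≤_; _<_; z≤n; s≤s)
  open import Data.Nat.DivMod using (_%_)
  open import Data.Nat.Properties
  open import Data.Nat.Tactic.RingSolver using (solve-∀)
  open import Data.Empty using (⊥-elim)
  open import Data.Product using (Σ; ∃; _×_; _,_; proj₁; proj₂)
  open import Data.Sum using (inj₁; inj₂)
  open import Relation.Binary.PropositionalEquality

  data Vertex : Set where
    +x -x +y -y +z -z : Vertex

  -- The digits (a, b, c, d) of a vertex are the bits with a + b = c + d for which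
  -- (a - d, a - c, 1 - a - b) is the unit vector pointing to that vertex.
  digits : Vertex → Bit⁴
  digits +x = b₁ , b₀ , b₁ , b₀
  digits -x = b₀ , b₁ , b₀ , b₁
  digits +y = b₁ , b₀ , b₀ , b₁
  digits -y = b₀ , b₁ , b₁ , b₀
  digits +z = b₀ , b₀ , b₀ , b₀
  digits -z = b₁ , b₁ , b₁ , b₁

  digits-balanced : ∀ δ → Balanced (bits (digits δ))
  digits-balanced +x = refl
  digits-balanced -x = refl
  digits-balanced +y = refl
  digits-balanced -y = refl
  digits-balanced +z = refl
  digits-balanced -z = refl

  digits-even : ∀ δ → sum (bits (digits δ)) % 2 ≡ 0
  digits-even +x = refl
  digits-even -x = refl
  digits-even +y = refl
  digits-even -y = refl
  digits-even +z = refl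
  digits-even -z = refl

  -- Address n q: q is the address of one of the octahedra making up S_n, the one obtained
  -- by refining at the vertices given by the successive binary digits of q.
  data Address : ℕ → Quad → Set where
    root  : Address 0 (0 , 0 , 0 , 0)
    child : ∀ {n q} δ → Address n q → Address (suc n) (digits δ ∷⁴ q)

  address-balanced : ∀ {n q} → Address n q → Balanced q
  address-balanced root                = refl
  address-balanced (child {q = q} δ α) = balanced-∷⁴ (digits δ) q (digits-balanced δ) (address-balanced α)

  address-xor : ∀ {n q} → Address n q → xor q ≡ 0
  address-xor root                = refl
  address-xor (child {q = q} δ α) =
    trans (xor-∷⁴ (digits δ) q) (cong₂ (λ p r → p + 2 * r) (digits-even δ) (address-xor α))

  low-digits-vertex : ∀ x q → Balanced (x ∷⁴ q) → xor (x ∷⁴ q) ≡ 0 → Σ Vertex λ δ → digits δ ≡ x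
  low-digits-vertex (b₀ , b₀ , b₀ , b₀) _ _ _ = +z , refl
  low-digits-vertex (b₁ , b₀ , b₁ , b₀) _ _ _ = +x , refl
  low-digits-vertex (b₀ , b₁ , b₀ , b₁) _ _ _ = -x , refl
  low-digits-vertex (b₁ , b₀ , b₀ , b₁) _ _ _ = +y , refl
  low-digits-vertex (b₀ , b₁ , b₁ , b₀) _ _ _ = -y , refl
  low-digits-vertex (b₁ , b₁ , b₁ , b₁) _ _ _ = -z , refl
  low-digits-vertex x@(b₀ , b₀ , b₁ , b₁) q@(a , b , c , d) balanced xor≡0 = ⊥-elim
    (carry-impossible a b c d (inj₁ (balanced-carry a b c d balanced)) (proj₂ (xor-halves x q xor≡0)))
  low-digits-vertex x@(b₁ , b₁ , b₀ , b₀) q@(a , b , c , d) balanced xor≡0 = ⊥-elim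
    (carry-impossible a b c d (inj₂ (balanced-carry c d a b (sym balanced))) (proj₂ (xor-halves x q xor≡0)))
  low-digits-vertex x@(b₁ , b₀ , b₀ , b₀) q _ xor≡0 = ⊥-elim (1+n≢0 (proj₁ (xor-halves x q xor≡0)))
  low-digits-vertex x@(b₀ , b₁ , b₀ , b₀) q _ xor≡0 = ⊥-elim (1+n≢0 (proj₁ (xor-halves x q xor≡0)))
  low-digits-vertex x@(b₀ , b₀ , b₁ , b₀) q _ xor≡0 = ⊥-elim (1+n≢0 (proj₁ (xor-halves x q xor≡0)))
  low-digits-vertex x@(b₀ , b₀ , b₀ , b₁) q _ xor≡0 = ⊥-elim (1+n≢0 (proj₁ (xor-halves x q xor≡0)))
  low-digits-vertex x@(b₀ , b₁ , b₁ , b₁) q _ xor≡0 = ⊥-elim (1+n≢0 (proj₁ (xor-halves x q xor≡0)))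
  low-digits-vertex x@(b₁ , b₀ , b₁ , b₁) q _ xor≡0 = ⊥-elim (1+n≢0 (proj₁ (xor-halves x q xor≡0)))
  low-digits-vertex x@(b₁ , b₁ , b₀ , b₁) q _ xor≡0 = ⊥-elim (1+n≢0 (proj₁ (xor-halves x q xor≡0)))
  low-digits-vertex x@(b₁ , b₁ , b₁ , b₀) q _ xor≡0 = ⊥-elim (1+n≢0 (proj₁ (xor-halves x q xor≡0)))

  address-complete : ∀ n q → Balanced q → level q < 2 ^ n → xor q ≡ 0 → Address n q
  address-complete zero (zero  , zero  , zero  , zero ) _  _        _ = root
  address-complete zero (suc _ , _     , _     , _    ) _  (s≤s ()) _
  address-complete zero (zero  , suc _ , _     , _    ) _  (s≤s ()) _
  address-complete zero (zero  , zero  , suc _ , _    ) () _        _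
  address-complete zero (zero  , zero  , zero  , suc _) () _        _
  address-complete (suc n) (a , b , c , d) balanced bound xor≡0
    with binary a | binary b | binary c | binary d
  ... | x ∷ a′ | y ∷ b′ | z ∷ c′ | w ∷ d′
    with low-digits-vertex (x , y , z , w) (a′ , b′ , c′ , d′) balanced xor≡0
  ... | δ , refl = child δ (address-complete n q′
        (balanced-halves (digits δ) q′ (digits-balanced δ) balanced)
        (level-halves (digits δ) q′ n bound)
        (proj₂ (xor-halves (digits δ) q′ xor≡0)))
    where q′ = a′ , b′ , c′ , d′

  P-position-address : ∀ {n m a c} → InP m (suc a) (suc c) → m ≤ 2 ^ n →
                       Address n (a , m ∸ suc a , c , m ∸ suc c)
  P-position-address {n} {m} {a} {c} (_ , i≤m , _ , j≤m , isP) m≤2ⁿ =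
    address-complete n _ (suc-injective (trans (m+[n∸m]≡n i≤m) (sym (m+[n∸m]≡n j≤m))))
                         (subst (_≤ 2 ^ n) (sym (m+[n∸m]≡n i≤m)) m≤2ⁿ) isP

  address-P-position : ∀ {n m a b c d} → Address n (a , b , c , d) → suc (a + b) ≡ m → InP m (suc a) (suc c)
  address-P-position {a = a} {b} {c} {d} α refl =
    s≤s z≤n , s≤s (m≤m+n a b) , s≤s z≤n , s≤s (subst (c ≤_) (sym a+b≡c+d) (m≤m+n c d)) ,
    subst₂ (λ b′ d′ → a ⊕ c ⊕ b′ ⊕ d′ ≡ 0) (sym (m+n∸m≡n a b))
           (sym (trans (cong (_∸ c) a+b≡c+d) (m+n∸m≡n c d))) (address-xor α)
    where a+b≡c+d = address-balanced α

  -- Step q q′: the octahedron of q′ lies one level deeper, with a horizontal vertex at the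
  -- lowest vertex of the octahedron of q; its horizontal centre is one unit further along x or y.
  data Step : Quad → Quad → Set where
    east  : ∀ {a b c d} → Step (a , b , c , d) (suc a , b , suc c , d)
    west  : ∀ {a b c d} → Step (a , b , c , d) (a , suc b , c , suc d)
    north : ∀ {a b c d} → Step (a , b , c , d) (suc a , b , c , suc d)
    south : ∀ {a b c d} → Step (a , b , c , d) (a , suc b , suc c , d)

  step-level : ∀ {q q′} → Step q q′ → level q′ ≡ suc (level q)
  step-level east            = refl
  step-level (west {a} {b})  = +-suc a b
  step-level north           = refl
  step-level (south {a} {b}) = +-suc a b

  Successor Predecessor : ℕ → Quad → Set
  Successor   n q = ∃ λ q′ → Step q q′ × Address n q′
  Predecessor n q = ∃ λ q′ → Step q′ q × Address n q′

  b₀∷suc : ∀ k → b₀ ∷ᵇ suc k ≡ suc (b₁ ∷ᵇ k)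
  b₀∷suc k = *-suc 2 k

  quad-subst : ∀ (P : Quad → Set) {a b c d a′ b′ c′ d′} → a ≡ a′ → b ≡ b′ → c ≡ c′ → d ≡ d′ →
               P (a , b , c , d) → P (a′ , b′ , c′ , d′)
  quad-subst P refl refl refl refl p = p

  -- Within a parent, the lowest vertex of every child but the −z one is a horizontal vertex of
  -- a sibling; that of the −z child is the lowest vertex of the parent.
  next-address : ∀ {n q} → Address n q → 2 + level q ≤ 2 ^ n → Successor n q
  next-address root (s≤s ())
  next-address (child +z α) _ = _ , east  , child +x α
  next-address (child +x α) _ = _ , west  , child -z α
  next-address (child -x α) _ = _ , east  , child -z α
  next-address (child +y α) _ = _ , south , child -z α
  next-address (child -y α) _ = _ , north , child -z α
  next-address {suc n} (child {q = q} -z α) bound with next-address α (*-cancelˡ-≤ 2 (begin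
    2 * (2 + level q)           ≡⟨ double-2+ (level q) ⟩
    2 + (2 + 2 * level q)       ≡⟨ cong (2 +_) (level-∷⁴ (digits -z) q) ⟨
    2 + level (digits -z ∷⁴ q)  ≤⟨ bound ⟩
    2 * 2 ^ n                   ∎))
    where
    open ≤-Reasoning
    double-2+ : ∀ l → 2 * (2 + l) ≡ 2 + (2 + 2 * l)
    double-2+ = solve-∀
  ... | _ , east  {a} {_} {c} {_} , α′ =
    _ , east  , quad-subst (Address (suc n)) (b₀∷suc a) refl (b₀∷suc c) refl (child -x α′)
  ... | _ , west  {_} {b} {_} {d} , α′ =
    _ , west  , quad-subst (Address (suc n)) refl (b₀∷suc b) refl (b₀∷suc d) (child +x α′)
  ... | _ , north {a} {_} {_} {d} , α′ =
    _ , north , quad-subst (Address (suc n)) (b₀∷suc a) refl refl (b₀∷suc d) (child -y α′)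
  ... | _ , south {_} {b} {c} {_} , α′ =
    _ , south , quad-subst (Address (suc n)) refl (b₀∷suc b) (b₀∷suc c) refl (child +y α′)

  -- Within a parent, every child but the +z one has a horizontal vertex that is the lowest
  -- vertex of a sibling.
  prev-address : ∀ {n q} → Address n q → 1 ≤ level q → Predecessor n q
  prev-address root ()
  prev-address (child -z α) _ = _ , west  , child +x α
  prev-address (child +x α) _ = _ , east  , child +z α
  prev-address (child -x α) _ = _ , west  , child +z α
  prev-address (child +y α) _ = _ , north , child +z α
  prev-address (child -y α) _ = _ , south , child +z α
  prev-address {suc n} (child {q = q} +z α) positive
    with prev-address α (half-positive (level q) (subst (1 ≤_) (level-∷⁴ (digits +z) q) positive))
    where
    half-positive : ∀ l → 1 ≤ 2 * l → 1 ≤ l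
    half-positive (suc l) _ = s≤s z≤n
  ... | _ , east  {a} {_} {c} {_} , α′ =
    quad-subst (Predecessor (suc n)) (sym (b₀∷suc a)) refl (sym (b₀∷suc c)) refl (_ , east , child +x α′)
  ... | _ , west  {_} {b} {_} {d} , α′ =
    quad-subst (Predecessor (suc n)) refl (sym (b₀∷suc b)) refl (sym (b₀∷suc d)) (_ , west , child -x α′)
  ... | _ , north {a} {_} {_} {d} , α′ =
    quad-subst (Predecessor (suc n)) (sym (b₀∷suc a)) refl refl (sym (b₀∷suc d)) (_ , north , child +y α′)
  ... | _ , south {_} {b} {c} {_} , α′ =
    quad-subst (Predecessor (suc n)) refl (sym (b₀∷suc b)) (sym (b₀∷suc c)) refl (_ , south , child -y α′)

module Embedding where
  open Binary using (bit; _∷ᵇ_)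
  open import Data.Nat as ℕ using (ℕ; suc)
  import Data.Nat.Properties as ℕ
  open import Data.Nat.Coprimality as Coprime using (1-coprimeTo)
  import Data.Integer as ℤ
  import Data.Integer.Properties as ℤ
  open import Data.Rational as ℚ using (ℚ; mkℚ; 0ℚ; 1ℚ; _+_; _≤_)
  open import Data.Rational.Properties using (normalize-coprime; nonNegative⁻¹)
  open import Relation.Binary.PropositionalEquality

  ⟦_⟧ : ℕ → ℚ
  ⟦_⟧ = ℕ→ℚ

  ⟦⟧-mkℚ : ∀ k → ⟦ k ⟧ ≡ mkℚ (ℤ.+ k) 0 (Coprime.sym (1-coprimeTo k))
  ⟦⟧-mkℚ k = normalize-coprime (Coprime.sym (1-coprimeTo k))

  ⟦⟧-+ : ∀ m n → ⟦ m ℕ.+ n ⟧ ≡ ⟦ m ⟧ + ⟦ n ⟧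
  ⟦⟧-+ m n rewrite ⟦⟧-mkℚ m | ⟦⟧-mkℚ n = cong (ℚ._/ 1)
    (trans (ℤ.pos-+ m n) (sym (cong₂ ℤ._+_ (ℤ.*-identityʳ (ℤ.+ m)) (ℤ.*-identityʳ (ℤ.+ n)))))

  ⟦⟧-suc : ∀ k → ⟦ suc k ⟧ ≡ 1ℚ + ⟦ k ⟧
  ⟦⟧-suc = ⟦⟧-+ 1

  ⟦suc+⟧ : ∀ a b → ⟦ suc (a ℕ.+ b) ⟧ ≡ 1ℚ + ⟦ a ⟧ + ⟦ b ⟧
  ⟦suc+⟧ a b = trans (⟦⟧-+ (suc a) b) (cong (_+ ⟦ b ⟧) (⟦⟧-suc a))

  ⟦⟧-∷ᵇ : ∀ x k → ⟦ x ∷ᵇ k ⟧ ≡ ⟦ bit x ⟧ + (⟦ k ⟧ + ⟦ k ⟧)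
  ⟦⟧-∷ᵇ x k = trans (⟦⟧-+ (bit x) (2 ℕ.* k)) (cong (⟦ bit x ⟧ +_)
    (trans (⟦⟧-+ k (k ℕ.+ 0)) (cong (λ l → ⟦ k ⟧ + ⟦ l ⟧) (ℕ.+-identityʳ k))))

  0≤⟦⟧ : ∀ k → 0ℚ ≤ ⟦ k ⟧
  0≤⟦⟧ k rewrite ⟦⟧-mkℚ k = nonNegative⁻¹ _

module AbsoluteValue where
  open import Data.Rational using (0ℚ; 1ℚ; ½; _+_; _-_; _*_; -_; ∣_∣; _≤_; Positive)
  open import Data.Rational.Properties
  open import Data.Rational.Solver using (module +-*-Solver)
  open +-*-Solver using (solve; _:+_; _:*_; _:-_; :-_; con; _:=_)
  open import Data.Product using (_×_; _,_)
  open import Data.Sum using (inj₁; inj₂)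
  open import Function.Bundles using (_⇔_; mk⇔; Equivalence)
  open import Relation.Binary.PropositionalEquality

  ≤-shift : ∀ {x y} k {x′ y′} → x + k ≡ x′ → y + k ≡ y′ → x ≤ y → x′ ≤ y′
  ≤-shift k x+k≡x′ y+k≡y′ x≤y = subst₂ _≤_ x+k≡x′ y+k≡y′ (+-monoˡ-≤ k x≤y)

  p≤∣p∣ : ∀ p → p ≤ ∣ p ∣
  p≤∣p∣ p with ≤-total 0ℚ p
  ... | inj₁ 0≤p = ≤-reflexive (sym (0≤p⇒∣p∣≡p 0≤p))
  ... | inj₂ p≤0 = ≤-trans p≤0 (0≤∣p∣ p)

  -p≤∣p∣ : ∀ p → - p ≤ ∣ p ∣
  -p≤∣p∣ p = subst (- p ≤_) (∣-p∣≡∣p∣ p) (p≤∣p∣ (- p))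

  ∣p∣≤r⇔ : ∀ {p r} → ∣ p ∣ ≤ r ⇔ (p ≤ r × - p ≤ r)
  ∣p∣≤r⇔ {p} {r} = mk⇔ (λ ∣p∣≤r → ≤-trans (p≤∣p∣ p) ∣p∣≤r , ≤-trans (-p≤∣p∣ p) ∣p∣≤r) from
    where
    from : p ≤ r × - p ≤ r → ∣ p ∣ ≤ r
    from (p≤r , -p≤r) with ∣p∣≡p∨∣p∣≡-p p
    ... | inj₁ ∣p∣≡p  = subst (_≤ r) (sym ∣p∣≡p) p≤r
    ... | inj₂ ∣p∣≡-p = subst (_≤ r) (sym ∣p∣≡-p) -p≤r

  ∣p-q∣≡∣q-p∣ : ∀ p q → ∣ p - q ∣ ≡ ∣ q - p ∣
  ∣p-q∣≡∣q-p∣ p q = trans (cong ∣_∣ (solve 2 (λ p q → p :- q := :- (q :- p)) refl p q)) (∣-p∣≡∣p∣ (q - p))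

  ∣r*p∣≡r*∣p∣ : ∀ {r} p → 0ℚ ≤ r → ∣ r * p ∣ ≡ r * ∣ p ∣
  ∣r*p∣≡r*∣p∣ {r} p 0≤r = trans (∣p*q∣≡∣p∣*∣q∣ r p) (cong (_* ∣ p ∣) (0≤p⇒∣p∣≡p 0≤r))

  ∣p∣+∣q∣≤0 : ∀ p q → ∣ p ∣ + ∣ q ∣ ≤ 0ℚ → p ≡ 0ℚ × q ≡ 0ℚ
  ∣p∣+∣q∣≤0 p q sum≤0 =
    ∣p∣≡0⇒p≡0 p (≤-antisym (≤-trans ∣p∣≤sum sum≤0) (0≤∣p∣ p)) ,
    ∣p∣≡0⇒p≡0 q (≤-antisym (≤-trans ∣q∣≤sum sum≤0) (0≤∣p∣ q))
    where
    ∣p∣≤sum = subst (_≤ ∣ p ∣ + ∣ q ∣) (+-identityʳ ∣ p ∣) (+-monoʳ-≤ ∣ p ∣ (0≤∣p∣ q))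
    ∣q∣≤sum = subst (_≤ ∣ p ∣ + ∣ q ∣) (+-identityˡ ∣ q ∣) (+-monoˡ-≤ ∣ q ∣ (0≤∣p∣ p))

  halve-≤ : ∀ {p r} → p + p ≤ r + r → p ≤ r
  halve-≤ {p} {r} 2p≤2r = subst₂ _≤_ (half-double p) (half-double r) (*-monoˡ-≤-nonNeg ½ 2p≤2r)
    where
    half-double : ∀ x → ½ * (x + x) ≡ x
    half-double = solve 1 (λ x → con ½ :* (x :+ x) := x) refl

  -- |p + q| + |p - q| = 2 max(|p|, |q|)
  ∣p+q∣+∣p-q∣≤2r⇔ : ∀ {p q r} → ∣ p + q ∣ + ∣ p - q ∣ ≤ r + r ⇔ (∣ p ∣ ≤ r × ∣ q ∣ ≤ r)
  ∣p+q∣+∣p-q∣≤2r⇔ {p} {q} {r} = mk⇔ to from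
    where
    to : ∣ p + q ∣ + ∣ p - q ∣ ≤ r + r → ∣ p ∣ ≤ r × ∣ q ∣ ≤ r
    to sum≤ = Equivalence.from ∣p∣≤r⇔ (p≤r , -p≤r) , Equivalence.from ∣p∣≤r⇔ (q≤r , -q≤r)
      where
      bound : ∀ x s t → x + x ≡ s + t → s ≤ ∣ p + q ∣ → t ≤ ∣ p - q ∣ → x ≤ r
      bound x s t x+x≡s+t s≤ t≤ = halve-≤ (subst (_≤ r + r) (sym x+x≡s+t) (≤-trans (+-mono-≤ s≤ t≤) sum≤))
      p≤r = bound p (p + q) (p - q)
        (solve 2 (λ p q → p :+ p := (p :+ q) :+ (p :- q)) refl p q) (p≤∣p∣ _) (p≤∣p∣ _)
      -p≤r = bound (- p) (- (p + q)) (- (p - q))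
        (solve 2 (λ p q → (:- p) :+ (:- p) := (:- (p :+ q)) :+ (:- (p :- q))) refl p q) (-p≤∣p∣ _) (-p≤∣p∣ _)
      q≤r = bound q (p + q) (- (p - q))
        (solve 2 (λ p q → q :+ q := (p :+ q) :+ (:- (p :- q))) refl p q) (p≤∣p∣ _) (-p≤∣p∣ _)
      -q≤r = bound (- q) (- (p + q)) (p - q)
        (solve 2 (λ p q → (:- q) :+ (:- q) := (:- (p :+ q)) :+ (p :- q)) refl p q) (-p≤∣p∣ _) (p≤∣p∣ _)

    twice : ∀ s t {x} → s + t ≡ x + x → x ≤ r → s + t ≤ r + r
    twice s t s+t≡x+x x≤r = subst (_≤ r + r) (sym s+t≡x+x) (+-mono-≤ x≤r x≤r)

    from : ∣ p ∣ ≤ r × ∣ q ∣ ≤ r → ∣ p + q ∣ + ∣ p - q ∣ ≤ r + r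
    from (∣p∣≤r , ∣q∣≤r) with Equivalence.to ∣p∣≤r⇔ ∣p∣≤r | Equivalence.to ∣p∣≤r⇔ ∣q∣≤r
                             | ∣p∣≡p∨∣p∣≡-p (p + q) | ∣p∣≡p∨∣p∣≡-p (p - q)
    ... | p≤r , _ | _ , _ | inj₁ e₁ | inj₁ e₂ rewrite e₁ | e₂ = twice (p + q) (p - q)
      (solve 2 (λ p q → (p :+ q) :+ (p :- q) := p :+ p) refl p q) p≤r
    ... | _ , -p≤r | _ , _ | inj₂ e₁ | inj₂ e₂ rewrite e₁ | e₂ = twice (- (p + q)) (- (p - q))
      (solve 2 (λ p q → (:- (p :+ q)) :+ (:- (p :- q)) := (:- p) :+ (:- p)) refl p q) -p≤r
    ... | _ , _ | q≤r , _ | inj₁ e₁ | inj₂ e₂ rewrite e₁ | e₂ = twice (p + q) (- (p - q))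
      (solve 2 (λ p q → (p :+ q) :+ (:- (p :- q)) := q :+ q) refl p q) q≤r
    ... | _ , _ | _ , -q≤r | inj₂ e₁ | inj₁ e₂ rewrite e₁ | e₂ = twice (- (p + q)) (p - q)
      (solve 2 (λ p q → (:- (p :+ q)) :+ (p :- q) := (:- q) :+ (:- q)) refl p q) -q≤r

  ≤-scale : ∀ {r} d e → .{{Positive r}} → d ≡ r * e → d ≤ r ⇔ e ≤ 1ℚ
  ≤-scale {r} d e d≡re = mk⇔
    (λ d≤r → *-cancelˡ-≤-pos r (subst₂ _≤_ d≡re (sym (*-identityʳ r)) d≤r))
    (λ e≤1 → subst₂ _≤_ (sym d≡re) (*-identityʳ r) (*-monoˡ-≤-nonNeg r {{pos⇒nonNeg r}} e≤1))

module Octahedra where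
  open Binary using (Bit; b₀; b₁; bit; _∷ᵇ_)
  open Quads using (Quad; _∷⁴_)
  open Addresses using (Vertex; +x; -x; +y; -y; +z; -z; digits; Address; root; child)
  open Embedding
  open import Data.Nat as ℕ using (ℕ; zero; suc)
  open import Data.Rational using (ℚ; 0ℚ; 1ℚ; ½; _+_; _-_; _*_)
  open import Data.Rational.Properties using (*-identityʳ; *-zeroʳ; +-identityʳ)
  open import Data.Rational.Solver using (module +-*-Solver)
  open +-*-Solver using (solve; _:+_; _:*_; _:-_; con; _:=_)
  open import Data.Product using (∃; _×_; _,_; proj₁; proj₂)
  open import Data.List.Relation.Unary.Any using (Any; here; there)
  open import Data.List.Relation.Unary.Any.Properties using (concatMap⁺; concatMap⁻)
  open import Relation.Binary.PropositionalEquality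

  octahedron : ℕ → Quad → Oct
  octahedron n (a , b , c , d) =
    oct (h * (⟦ a ⟧ - ⟦ d ⟧) , h * (⟦ a ⟧ - ⟦ c ⟧) , 1ℚ - h * ⟦ suc (a ℕ.+ b) ⟧) h
    where h = halfPow n

  shift : Bit → Bit → ℚ → ℚ → ℚ
  shift b₁ b₀ x h = x + h
  shift b₀ b₁ x h = x - h
  shift b₀ b₀ x h = x
  shift b₁ b₁ x h = x

  shift-≡ : ∀ p q x h → shift p q x h ≡ x + h * (⟦ bit p ⟧ - ⟦ bit q ⟧)
  shift-≡ b₁ b₀ x h = cong (x +_) (sym (*-identityʳ h))
  shift-≡ b₀ b₁ x h = solve 2 (λ x h → x :- h := x :+ h :* (con 0ℚ :- con 1ℚ)) refl x h
  shift-≡ b₀ b₀ x h = sym (trans (cong (x +_) (*-zeroʳ h)) (+-identityʳ x))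
  shift-≡ b₁ b₁ x h = sym (trans (cong (x +_) (*-zeroʳ h)) (+-identityʳ x))

  complement : Bit → Bit
  complement b₀ = b₁
  complement b₁ = b₀

  ⟦complement⟧ : ∀ p → ⟦ bit (complement p) ⟧ ≡ 1ℚ - ⟦ bit p ⟧
  ⟦complement⟧ b₀ = refl
  ⟦complement⟧ b₁ = refl

  -- The member of T o at the vertex δ: the centre of o moves by half its radius along the
  -- unit vector (a - d, a - c, 1 - a - b) of the digits (a, b, c, d) of δ.
  childOct : Vertex → Oct → Oct
  childOct δ (oct (x , y , z) r) = oct (shift a d x h , shift a c y h , shift (complement a) b z h) h
    where
    h = ½ * r
    a = proj₁ (digits δ)
    b = proj₁ (proj₂ (digits δ))
    c = proj₁ (proj₂ (proj₂ (digits δ)))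
    d = proj₂ (proj₂ (proj₂ (digits δ)))

  Any-T⁺ : ∀ {P : Oct → Set} δ o → P (childOct δ o) → Any P (T o)
  Any-T⁺ +x o p = here p
  Any-T⁺ -x o p = there (here p)
  Any-T⁺ +y o p = there (there (here p))
  Any-T⁺ -y o p = there (there (there (here p)))
  Any-T⁺ +z o p = there (there (there (there (here p))))
  Any-T⁺ -z o p = there (there (there (there (there (here p)))))

  Any-T⁻ : ∀ {P : Oct → Set} o → Any P (T o) → ∃ λ δ → P (childOct δ o)
  Any-T⁻ o (here p)                                          = +x , p
  Any-T⁻ o (there (here p))                                  = -x , p
  Any-T⁻ o (there (there (here p)))                          = +y , p
  Any-T⁻ o (there (there (there (here p))))                  = -y , p
  Any-T⁻ o (there (there (there (there (here p)))))          = +z , p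
  Any-T⁻ o (there (there (there (there (there (here p)))))) = -z , p

  planar-shift : ∀ p q a d h →
    shift p q (h * (⟦ a ⟧ - ⟦ d ⟧)) (½ * h) ≡ ½ * h * (⟦ p ∷ᵇ a ⟧ - ⟦ q ∷ᵇ d ⟧)
  planar-shift p q a d h = begin
    shift p q (h * (⟦ a ⟧ - ⟦ d ⟧)) (½ * h)
      ≡⟨ shift-≡ p q _ (½ * h) ⟩
    h * (⟦ a ⟧ - ⟦ d ⟧) + ½ * h * (⟦ bit p ⟧ - ⟦ bit q ⟧)
      ≡⟨ solve 5 (λ h A D P Q → h :* (A :- D) :+ con ½ :* h :* (P :- Q)
                                := con ½ :* h :* ((P :+ (A :+ A)) :- (Q :+ (D :+ D))))
               refl h ⟦ a ⟧ ⟦ d ⟧ ⟦ bit p ⟧ ⟦ bit q ⟧ ⟩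
    ½ * h * ((⟦ bit p ⟧ + (⟦ a ⟧ + ⟦ a ⟧)) - (⟦ bit q ⟧ + (⟦ d ⟧ + ⟦ d ⟧)))
      ≡⟨ cong₂ (λ P Q → ½ * h * (P - Q)) (⟦⟧-∷ᵇ p a) (⟦⟧-∷ᵇ q d) ⟨
    ½ * h * (⟦ p ∷ᵇ a ⟧ - ⟦ q ∷ᵇ d ⟧)
      ∎
    where open ≡-Reasoning

  height-shift : ∀ p q a b h → shift (complement p) q (1ℚ - h * ⟦ suc (a ℕ.+ b) ⟧) (½ * h)
                                ≡ 1ℚ - ½ * h * ⟦ suc ((p ∷ᵇ a) ℕ.+ (q ∷ᵇ b)) ⟧
  height-shift p q a b h = begin
    shift (complement p) q (1ℚ - h * ⟦ suc (a ℕ.+ b) ⟧) (½ * h)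
      ≡⟨ shift-≡ (complement p) q _ (½ * h) ⟩
    1ℚ - h * ⟦ suc (a ℕ.+ b) ⟧ + ½ * h * (⟦ bit (complement p) ⟧ - ⟦ bit q ⟧)
      ≡⟨ cong₂ (λ L P → 1ℚ - h * L + ½ * h * (P - ⟦ bit q ⟧)) (⟦suc+⟧ a b) (⟦complement⟧ p) ⟩
    1ℚ - h * (1ℚ + ⟦ a ⟧ + ⟦ b ⟧) + ½ * h * (1ℚ - ⟦ bit p ⟧ - ⟦ bit q ⟧)
      ≡⟨ solve 6 (λ h A B P Q one → one :- h :* (one :+ A :+ B) :+ con ½ :* h :* (one :- P :- Q)
                                    := one :- con ½ :* h :* (one :+ (P :+ (A :+ A)) :+ (Q :+ (B :+ B))))
               refl h ⟦ a ⟧ ⟦ b ⟧ ⟦ bit p ⟧ ⟦ bit q ⟧ 1ℚ ⟩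
    1ℚ - ½ * h * (1ℚ + (⟦ bit p ⟧ + (⟦ a ⟧ + ⟦ a ⟧)) + (⟦ bit q ⟧ + (⟦ b ⟧ + ⟦ b ⟧)))
      ≡⟨ cong (λ L → 1ℚ - ½ * h * L) (trans (⟦suc+⟧ (p ∷ᵇ a) (q ∷ᵇ b))
                                             (cong₂ (λ P Q → 1ℚ + P + Q) (⟦⟧-∷ᵇ p a) (⟦⟧-∷ᵇ q b))) ⟨
    1ℚ - ½ * h * ⟦ suc ((p ∷ᵇ a) ℕ.+ (q ∷ᵇ b)) ⟧
      ∎
    where open ≡-Reasoning

  child-octahedron : ∀ n δ q → childOct δ (octahedron n q) ≡ octahedron (suc n) (digits δ ∷⁴ q)
  child-octahedron n δ (a , b , c , d) = cong (λ centre → oct centre (½ * h))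
    (cong₂ _,_ (planar-shift x w a d h) (cong₂ _,_ (planar-shift x z a c h) (height-shift x y a b h)))
    where
    h = halfPow n
    x = proj₁ (digits δ)
    y = proj₁ (proj₂ (digits δ))
    z = proj₁ (proj₂ (proj₂ (digits δ)))
    w = proj₂ (proj₂ (proj₂ (digits δ)))

  Any-S⁻ : ∀ n {P : Oct → Set} → Any P (S n) → ∃ λ q → Address n q × P (octahedron n q)
  Any-S⁻ zero    (here p) = _ , root , p
  Any-S⁻ (suc n) {P} any =
    let q , α , any-T = Any-S⁻ n (concatMap⁻ T any)
        δ , p         = Any-T⁻ (octahedron n q) any-T
    in  digits δ ∷⁴ q , child δ α , subst P (child-octahedron n δ q) p

  Any-S⁺ : ∀ {n q} {P : Oct → Set} → Address n q → P (octahedron n q) → Any P (S n)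
  Any-S⁺ root p = here p
  Any-S⁺ {P = P} (child {n} {q} δ α) p =
    concatMap⁺ T (Any-S⁺ α (Any-T⁺ δ (octahedron n q) (subst P (sym (child-octahedron n δ q)) p)))

module Section where
  open Quads using (Quad; level)
  open Addresses using (Address; Step; east; west; north; south; step-level; next-address; prev-address)
  open Embedding
  open AbsoluteValue
  open Octahedra using (octahedron)
  open import Data.Nat as ℕ using (ℕ; zero; suc; Ordering; less; equal; greater; compare)
  import Data.Nat.Properties as ℕ
  import Data.Integer as ℤ
  open import Data.Rational as ℚ using (ℚ; 0ℚ; 1ℚ; ½; _+_; _-_; _*_; -_; ∣_∣; _≤_; Positive)
  open import Data.Rational.Properties
  open import Data.Rational.Solver using (module +-*-Solver)
  open +-*-Solver using (solve; _:+_; _:*_; _:-_; :-_; con; _:=_)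
  open import Data.Bool using (false)
  open import Data.Empty using (⊥; ⊥-elim)
  open import Data.Product using (∃; _×_; _,_)
  open import Function.Bundles using (_⇔_; mk⇔; Equivalence)
  import Function.Properties.Equivalence as ⇔
  open import Relation.Nullary using (¬_)
  open import Relation.Binary.PropositionalEquality

  halfPow-positive : ∀ n → Positive (halfPow n)
  halfPow-positive zero    = _
  halfPow-positive (suc n) = pos*pos⇒pos ½ (halfPow n) {{halfPow-positive n}}

  -- (u , v) ↦ 2⁻ⁿ (u + v - m , u - v): it maps the unit cells of the board onto the squares,
  -- rotated by 45°, in which the plane of level m cuts the octahedra of that level.
  similarity : ℕ → ℕ → Similarity
  similarity n m = record
    { a = h ; b = h ; c = - (h * ⟦ m ⟧) ; d = 0ℚ ; orient = false
    ; nondeg = λ (h≡0 , _) → <-irrefl (sym h≡0) (positive⁻¹ h {{halfPow-positive n}}) }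
    where h = halfPow n

  liftToLevel : ℕ → ℕ → Point2 → Point3
  liftToLevel n m (x , y) = x , y , 1ℚ - ⟦ m ⟧ * halfPow n

  centreˣ centreʸ : Quad → ℚ
  centreˣ (a , _ , _ , d) = ⟦ a ⟧ - ⟦ d ⟧
  centreʸ (a , _ , c , _) = ⟦ a ⟧ - ⟦ c ⟧

  -- Scaled by 2ⁿ, the point of level m over the image of (u , v) has horizontal coordinates
  -- (u + v - m , u - v), and the octahedron of q has radius 1, horizontal centre
  -- (centreˣ q , centreʸ q) and level 1 + level q.
  planarDistance : ℕ → Quad → Point2 → ℚ
  planarDistance m q (u , v) = ∣ u + v - ⟦ m ⟧ - centreˣ q ∣ + ∣ u - v - centreʸ q ∣

  boardDistance : ℕ → Quad → Point2 → ℚ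
  boardDistance m q p = planarDistance m q p + ∣ ⟦ suc (level q) ⟧ - ⟦ m ⟧ ∣

  octahedron-section : ∀ n m q p →
    InOct (octahedron n q) (liftToLevel n m (apply (similarity n m) p)) ⇔ boardDistance m q p ≤ 1ℚ
  octahedron-section n m q@(a , b , c , d) (u , v) =
    ≤-scale _ (boardDistance m q (u , v)) {{halfPow-positive n}} (begin
      ∣ h * u - - 1ℚ * h * v + - (h * M) - h * X ∣ + ∣ h * u + - 1ℚ * h * v + 0ℚ - h * Y ∣
        + ∣ 1ℚ - M * h - (1ℚ - h * L) ∣
        ≡⟨ cong₂ _+_ (cong₂ _+_ (cong ∣_∣ eqˣ) (cong ∣_∣ eqʸ)) (cong ∣_∣ eqᶻ) ⟩
      ∣ h * (u + v - M - X) ∣ + ∣ h * (u - v - Y) ∣ + ∣ h * (L - M) ∣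
        ≡⟨ cong₂ _+_ (cong₂ _+_ (∣r*p∣≡r*∣p∣ _ 0≤h) (∣r*p∣≡r*∣p∣ _ 0≤h)) (∣r*p∣≡r*∣p∣ _ 0≤h) ⟩
      h * ∣ u + v - M - X ∣ + h * ∣ u - v - Y ∣ + h * ∣ L - M ∣
        ≡⟨ solve 4 (λ h s t r → h :* s :+ h :* t :+ h :* r := h :* (s :+ t :+ r)) refl h _ _ _ ⟩
      h * boardDistance m q (u , v)
        ∎)
    where
    open ≡-Reasoning
    h = halfPow n
    M = ⟦ m ⟧
    L = ⟦ suc (level q) ⟧
    X = centreˣ q
    Y = centreʸ q
    0≤h = <⇒≤ (positive⁻¹ h {{halfPow-positive n}})
    eqˣ : h * u - - 1ℚ * h * v + - (h * M) - h * X ≡ h * (u + v - M - X)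
    eqˣ = solve 5 (λ h u v M X → h :* u :- (:- con 1ℚ) :* h :* v :+ (:- (h :* M)) :- h :* X
                                 := h :* (u :+ v :- M :- X)) refl h u v M X
    eqʸ : h * u + - 1ℚ * h * v + 0ℚ - h * Y ≡ h * (u - v - Y)
    eqʸ = solve 4 (λ h u v Y → h :* u :+ (:- con 1ℚ) :* h :* v :+ con 0ℚ :- h :* Y
                               := h :* (u :- v :- Y)) refl h u v Y
    eqᶻ : 1ℚ - M * h - (1ℚ - h * L) ≡ h * (L - M)
    eqᶻ = solve 4 (λ one h M L → one :- M :* h :- (one :- h :* L) := h :* (L :- M)) refl 1ℚ h M L

  InCell : ℕ → ℕ → Point2 → Set
  InCell i j (u , v) = (⟦ i ⟧ - 1ℚ ≤ u) × (u ≤ ⟦ i ⟧) × (⟦ j ⟧ - 1ℚ ≤ v) × (v ≤ ⟦ j ⟧)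

  ∣x-k+½∣≤½⇔ : ∀ k x → ∣ x - k + ½ ∣ ≤ ½ ⇔ (k - 1ℚ ≤ x × x ≤ k)
  ∣x-k+½∣≤½⇔ k x = ⇔.trans ∣p∣≤r⇔
    (mk⇔ (λ (upper , lower) → lower⇒ lower , upper⇒ upper) (λ (k-1≤x , x≤k) → ⇒upper x≤k , ⇒lower k-1≤x))
    where
    upper⇒ : x - k + ½ ≤ ½ → x ≤ k
    upper⇒ = ≤-shift (k - ½) (solve 2 (λ k x → x :- k :+ con ½ :+ (k :- con ½) := x) refl k x)
                             (solve 1 (λ k → con ½ :+ (k :- con ½) := k) refl k)
    lower⇒ : - (x - k + ½) ≤ ½ → k - 1ℚ ≤ x
    lower⇒ = ≤-shift (x - ½) (solve 2 (λ k x → :- (x :- k :+ con ½) :+ (x :- con ½) := k :- con 1ℚ) refl k x)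
                             (solve 1 (λ x → con ½ :+ (x :- con ½) := x) refl x)
    ⇒upper : x ≤ k → x - k + ½ ≤ ½
    ⇒upper = ≤-shift (½ - k) (solve 2 (λ k x → x :+ (con ½ :- k) := x :- k :+ con ½) refl k x)
                             (solve 1 (λ k → k :+ (con ½ :- k) := con ½) refl k)
    ⇒lower : k - 1ℚ ≤ x → - (x - k + ½) ≤ ½
    ⇒lower = ≤-shift (½ - x) (solve 2 (λ k x → k :- con 1ℚ :+ (con ½ :- x) := :- (x :- k :+ con ½)) refl k x)
                             (solve 1 (λ x → x :+ (con ½ :- x) := con ½) refl x)

  ⟦balance⟧ : ∀ a b c d → a ℕ.+ b ≡ c ℕ.+ d → ⟦ d ⟧ ≡ ⟦ a ⟧ + ⟦ b ⟧ - ⟦ c ⟧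
  ⟦balance⟧ a b c d a+b≡c+d = begin
    ⟦ d ⟧                  ≡⟨ solve 2 (λ c d → d := c :+ d :- c) refl ⟦ c ⟧ ⟦ d ⟧ ⟩
    ⟦ c ⟧ + ⟦ d ⟧ - ⟦ c ⟧  ≡⟨ cong (_- ⟦ c ⟧) (⟦⟧-+ c d) ⟨
    ⟦ c ℕ.+ d ⟧ - ⟦ c ⟧    ≡⟨ cong (λ s → ⟦ s ⟧ - ⟦ c ⟧) a+b≡c+d ⟨
    ⟦ a ℕ.+ b ⟧ - ⟦ c ⟧    ≡⟨ cong (_- ⟦ c ⟧) (⟦⟧-+ a b) ⟩
    ⟦ a ⟧ + ⟦ b ⟧ - ⟦ c ⟧  ∎
    where open ≡-Reasoning

  level-gap≡ : ∀ P ℓ → P + ∣ ⟦ ℓ ⟧ - ⟦ ℓ ⟧ ∣ ≡ P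
  level-gap≡ P ℓ = trans (cong (λ s → P + ∣ s ∣) (+-inverseʳ ⟦ ℓ ⟧)) (+-identityʳ P)

  cell-distance : ∀ a b c d u v → a ℕ.+ b ≡ c ℕ.+ d →
    let σ = u - ⟦ suc a ⟧ + ½ ; τ = v - ⟦ suc c ⟧ + ½ in
    boardDistance (suc (a ℕ.+ b)) (a , b , c , d) (u , v) ≡ ∣ σ + τ ∣ + ∣ σ - τ ∣
  cell-distance a b c d u v balanced = trans (level-gap≡ _ (suc (a ℕ.+ b))) (cong₂ (λ s t → ∣ s ∣ + ∣ t ∣)
    (begin
      u + v - ⟦ suc (a ℕ.+ b) ⟧ - (⟦ a ⟧ - ⟦ d ⟧)
        ≡⟨ cong₂ (λ L D → u + v - L - (⟦ a ⟧ - D)) (⟦suc+⟧ a b) (⟦balance⟧ a b c d balanced) ⟩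
      u + v - (1ℚ + ⟦ a ⟧ + ⟦ b ⟧) - (⟦ a ⟧ - (⟦ a ⟧ + ⟦ b ⟧ - ⟦ c ⟧))
        ≡⟨ solve 5 (λ u v A B C → u :+ v :- (con 1ℚ :+ A :+ B) :- (A :- (A :+ B :- C))
                                  := (u :- (con 1ℚ :+ A) :+ con ½) :+ (v :- (con 1ℚ :+ C) :+ con ½))
                   refl u v ⟦ a ⟧ ⟦ b ⟧ ⟦ c ⟧ ⟩
      (u - (1ℚ + ⟦ a ⟧) + ½) + (v - (1ℚ + ⟦ c ⟧) + ½)
        ≡⟨ cong₂ (λ s t → (u - s + ½) + (v - t + ½)) (⟦⟧-suc a) (⟦⟧-suc c) ⟨
      (u - ⟦ suc a ⟧ + ½) + (v - ⟦ suc c ⟧ + ½)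
        ∎)
    (begin
      u - v - (⟦ a ⟧ - ⟦ c ⟧)
        ≡⟨ solve 5 (λ one u v A C → u :- v :- (A :- C)
                                    := (u :- (one :+ A) :+ con ½) :- (v :- (one :+ C) :+ con ½))
                   refl 1ℚ u v ⟦ a ⟧ ⟦ c ⟧ ⟩
      (u - (1ℚ + ⟦ a ⟧) + ½) - (v - (1ℚ + ⟦ c ⟧) + ½)
        ≡⟨ cong₂ (λ s t → (u - s + ½) - (v - t + ½)) (⟦⟧-suc a) (⟦⟧-suc c) ⟨
      (u - ⟦ suc a ⟧ + ½) - (v - ⟦ suc c ⟧ + ½)
        ∎))
    where open ≡-Reasoning

  cell-section : ∀ {n m a b c d} → Address n (a , b , c , d) → suc (a ℕ.+ b) ≡ m →
                 ∀ p → boardDistance m (a , b , c , d) p ≤ 1ℚ ⇔ InCell (suc a) (suc c) p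
  cell-section {a = a} {b} {c} {d} α refl (u , v) =
    ⇔.trans (≤1-cong (cell-distance a b c d u v (Addresses.address-balanced α))) (⇔.trans ∣p+q∣+∣p-q∣≤2r⇔ (mk⇔
      (λ (σ≤½ , τ≤½) → let (i-1≤u , u≤i) = Equivalence.to (∣x-k+½∣≤½⇔ ⟦ suc a ⟧ u) σ≤½
                           (j-1≤v , v≤j) = Equivalence.to (∣x-k+½∣≤½⇔ ⟦ suc c ⟧ v) τ≤½
                       in  i-1≤u , u≤i , j-1≤v , v≤j)
      (λ (i-1≤u , u≤i , j-1≤v , v≤j) → Equivalence.from (∣x-k+½∣≤½⇔ ⟦ suc a ⟧ u) (i-1≤u , u≤i) ,
                                       Equivalence.from (∣x-k+½∣≤½⇔ ⟦ suc c ⟧ v) (j-1≤v , v≤j))))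
    where
    ≤1-cong : ∀ {x y} → x ≡ y → x ≤ 1ℚ ⇔ y ≤ ½ + ½
    ≤1-cong refl = ⇔.refl

  -⟦suc⟧ˡ : ∀ x y → (⟦ x ⟧ - ⟦ y ⟧) - (⟦ suc x ⟧ - ⟦ y ⟧) ≡ - 1ℚ
  -⟦suc⟧ˡ x y = trans (cong (λ s → (⟦ x ⟧ - ⟦ y ⟧) - (s - ⟦ y ⟧)) (⟦⟧-suc x))
    (solve 3 (λ one x y → (x :- y) :- ((one :+ x) :- y) := :- one) refl 1ℚ ⟦ x ⟧ ⟦ y ⟧)

  -⟦suc⟧ʳ : ∀ x y → (⟦ x ⟧ - ⟦ y ⟧) - (⟦ x ⟧ - ⟦ suc y ⟧) ≡ 1ℚ
  -⟦suc⟧ʳ x y = trans (cong (λ s → (⟦ x ⟧ - ⟦ y ⟧) - (⟦ x ⟧ - s)) (⟦⟧-suc y))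
    (solve 3 (λ one x y → (x :- y) :- (x :- (one :+ y)) := one) refl 1ℚ ⟦ x ⟧ ⟦ y ⟧)

  -⟦suc⟧ˡʳ : ∀ x y → (⟦ x ⟧ - ⟦ y ⟧) - (⟦ suc x ⟧ - ⟦ suc y ⟧) ≡ 0ℚ
  -⟦suc⟧ˡʳ x y = trans (cong₂ (λ s t → (⟦ x ⟧ - ⟦ y ⟧) - (s - t)) (⟦⟧-suc x) (⟦⟧-suc y))
    (solve 3 (λ one x y → (x :- y) :- ((one :+ x) :- (one :+ y)) := con 0ℚ) refl 1ℚ ⟦ x ⟧ ⟦ y ⟧)

  taxicab-unit : ∀ {s t s′ t′} → s ≡ s′ → t ≡ t′ → ∣ s′ ∣ + ∣ t′ ∣ ≡ 1ℚ → ∣ s ∣ + ∣ t ∣ ≡ 1ℚ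
  taxicab-unit refl refl unit = unit

  step-distance : ∀ {q q′} → Step q q′ → ∣ centreˣ q - centreˣ q′ ∣ + ∣ centreʸ q - centreʸ q′ ∣ ≡ 1ℚ
  step-distance (east  {a} {_} {c} {d}) = taxicab-unit (-⟦suc⟧ˡ a d) (-⟦suc⟧ˡʳ a c) refl
  step-distance (west  {a} {_} {c} {d}) = taxicab-unit (-⟦suc⟧ʳ a d) (+-inverseʳ (⟦ a ⟧ - ⟦ c ⟧)) refl
  step-distance (north {a} {_} {c} {d}) = taxicab-unit (-⟦suc⟧ˡʳ a d) (-⟦suc⟧ˡ a c) refl
  step-distance (south {a} {_} {c} {d}) = taxicab-unit (+-inverseʳ (⟦ a ⟧ - ⟦ d ⟧)) (-⟦suc⟧ʳ a c) refl

  step-distance⁻ : ∀ {q q′} → Step q′ q → ∣ centreˣ q - centreˣ q′ ∣ + ∣ centreʸ q - centreʸ q′ ∣ ≡ 1ℚ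
  step-distance⁻ {q} {q′} step =
    trans (cong₂ _+_ (∣p-q∣≡∣q-p∣ (centreˣ q) (centreˣ q′)) (∣p-q∣≡∣q-p∣ (centreʸ q) (centreʸ q′)))
          (step-distance step)

  planar-vertex : ∀ m q q′ p → planarDistance m q p ≤ 0ℚ →
                  planarDistance m q′ p ≡ ∣ centreˣ q - centreˣ q′ ∣ + ∣ centreʸ q - centreʸ q′ ∣
  planar-vertex m q q′ (u , v) distance≤0 =
    let (X-centreˣ≡0 , Y-centreʸ≡0) = ∣p∣+∣q∣≤0 (X - centreˣ q) (Y - centreʸ q) distance≤0
    in  cong₂ (λ s t → ∣ s ∣ + ∣ t ∣) (recentre X (centreˣ q) (centreˣ q′) X-centreˣ≡0)
                                      (recentre Y (centreʸ q) (centreʸ q′) Y-centreʸ≡0)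
    where
    X = u + v - ⟦ m ⟧
    Y = u - v
    recentre : ∀ x c c′ → x - c ≡ 0ℚ → x - c′ ≡ c - c′
    recentre x c c′ x-c≡0 = begin
      x - c′              ≡⟨ solve 3 (λ x c c′ → x :- c′ := (x :- c) :+ (c :- c′)) refl x c c′ ⟩
      (x - c) + (c - c′)  ≡⟨ cong (_+ (c - c′)) x-c≡0 ⟩
      0ℚ + (c - c′)       ≡⟨ +-identityˡ (c - c′) ⟩
      c - c′              ∎
      where open ≡-Reasoning

  0≤planarDistance : ∀ m q p → 0ℚ ≤ planarDistance m q p
  0≤planarDistance m q (u , v) = +-mono-≤ (0≤∣p∣ (u + v - ⟦ m ⟧ - centreˣ q)) (0≤∣p∣ (u - v - centreʸ q))

  ∣⟦m⟧-⟦m+k⟧∣≡⟦k⟧ : ∀ m k → ∣ ⟦ m ⟧ - ⟦ m ℕ.+ k ⟧ ∣ ≡ ⟦ k ⟧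
  ∣⟦m⟧-⟦m+k⟧∣≡⟦k⟧ m k = begin
    ∣ ⟦ m ⟧ - ⟦ m ℕ.+ k ⟧ ∣      ≡⟨ cong (λ s → ∣ ⟦ m ⟧ - s ∣) (⟦⟧-+ m k) ⟩
    ∣ ⟦ m ⟧ - (⟦ m ⟧ + ⟦ k ⟧) ∣  ≡⟨ cong ∣_∣ (solve 2 (λ m k → m :- (m :+ k) := :- k) refl ⟦ m ⟧ ⟦ k ⟧) ⟩
    ∣ - ⟦ k ⟧ ∣                  ≡⟨ ∣-p∣≡∣p∣ ⟦ k ⟧ ⟩
    ∣ ⟦ k ⟧ ∣                    ≡⟨ 0≤p⇒∣p∣≡p (0≤⟦⟧ k) ⟩
    ⟦ k ⟧                        ∎
    where open ≡-Reasoning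

  level-gap< : ∀ ℓ k → ∣ ⟦ ℓ ⟧ - ⟦ suc (ℓ ℕ.+ k) ⟧ ∣ ≡ ⟦ suc k ⟧
  level-gap< ℓ k = trans (cong (λ s → ∣ ⟦ ℓ ⟧ - ⟦ s ⟧ ∣) (sym (ℕ.+-suc ℓ k))) (∣⟦m⟧-⟦m+k⟧∣≡⟦k⟧ ℓ (suc k))

  level-gap> : ∀ m k → ∣ ⟦ suc (m ℕ.+ k) ⟧ - ⟦ m ⟧ ∣ ≡ ⟦ suc k ⟧
  level-gap> m k = trans (∣p-q∣≡∣q-p∣ ⟦ suc (m ℕ.+ k) ⟧ ⟦ m ⟧) (level-gap< m k)

  adjacent-level : ∀ {P g} → g ≡ ⟦ 1 ⟧ → P + g ≤ 1ℚ → P ≤ 0ℚ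
  adjacent-level {P} refl = ≤-shift (- 1ℚ) (solve 1 (λ P → P :+ con 1ℚ :+ (:- con 1ℚ) := P) refl P) refl

  distant-level : ∀ m q p {g} k → g ≡ ⟦ suc (suc k) ⟧ → planarDistance m q p + g ≤ 1ℚ → ⊥
  distant-level m q p k refl close = 2≰1 (begin
    ⟦ 2 ⟧            ≤⟨ subst (_≤ ⟦ 2 ⟧ + ⟦ k ⟧) (+-identityʳ ⟦ 2 ⟧) (+-monoʳ-≤ ⟦ 2 ⟧ (0≤⟦⟧ k)) ⟩
    ⟦ 2 ⟧ + ⟦ k ⟧    ≡⟨ ⟦⟧-+ 2 k ⟨
    ⟦ 2 ℕ.+ k ⟧      ≤⟨ subst (_≤ P + ⟦ 2 ℕ.+ k ⟧) (+-identityˡ _) (+-monoˡ-≤ ⟦ 2 ℕ.+ k ⟧ 0≤P) ⟩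
    P + ⟦ 2 ℕ.+ k ⟧  ≤⟨ close ⟩
    1ℚ               ∎)
    where
    open ≤-Reasoning
    P = planarDistance m q p
    0≤P = 0≤planarDistance m q p
    2≰1 : ¬ ⟦ 2 ⟧ ≤ 1ℚ
    2≰1 (ℚ.*≤* (ℤ.+≤+ (ℕ.s≤s ())))

  boardDistance-at-level : ∀ {m} q p → suc (level q) ≡ m → boardDistance m q p ≡ planarDistance m q p
  boardDistance-at-level {m} q p refl = level-gap≡ _ m

  AtLevel : ℕ → ℕ → Point2 → Set
  AtLevel n m p = ∃ λ q → Address n q × suc (level q) ≡ m × boardDistance m q p ≤ 1ℚ

  vertex-at-level : ∀ {n m} q q′ p → Address n q′ → suc (level q′) ≡ m → planarDistance m q p ≤ 0ℚ →
    ∣ centreˣ q - centreˣ q′ ∣ + ∣ centreʸ q - centreʸ q′ ∣ ≡ 1ℚ → AtLevel n m p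
  vertex-at-level {m = m} q q′ p α′ level≡ vertex unit = q′ , α′ , level≡ , ≤-reflexive (begin
    boardDistance m q′ p                                   ≡⟨ boardDistance-at-level q′ p level≡ ⟩
    planarDistance m q′ p                                  ≡⟨ planar-vertex m q q′ p vertex ⟩
    ∣ centreˣ q - centreˣ q′ ∣ + ∣ centreʸ q - centreʸ q′ ∣  ≡⟨ unit ⟩
    1ℚ                                                     ∎)
    where open ≡-Reasoning

  section-above : ∀ {n m} q p → Address n q → 2 ℕ.+ level q ≡ m → m ℕ.≤ 2 ℕ.^ n →
                  planarDistance m q p ≤ 0ℚ → AtLevel n m p
  section-above {n} q p α level≡ m≤2ⁿ vertex =
    let q′ , step , α′ = next-address α (subst (ℕ._≤ 2 ℕ.^ n) (sym level≡) m≤2ⁿ)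
    in  vertex-at-level q q′ p α′ (trans (cong suc (step-level step)) level≡) vertex (step-distance step)

  section-below : ∀ {n m} q p → Address n q → level q ≡ m → 1 ℕ.≤ m →
                  planarDistance m q p ≤ 0ℚ → AtLevel n m p
  section-below q p α level≡ 1≤m vertex =
    let q′ , step , α′ = prev-address α (subst (1 ℕ.≤_) (sym level≡) 1≤m)
    in  vertex-at-level q q′ p α′ (trans (sym (step-level step)) level≡) vertex (step-distance⁻ step)

  section-by-level : ∀ {n m ℓ} q p → Ordering ℓ m → suc (level q) ≡ ℓ → 1 ℕ.≤ m → m ℕ.≤ 2 ℕ.^ n →
    Address n q → planarDistance m q p + ∣ ⟦ ℓ ⟧ - ⟦ m ⟧ ∣ ≤ 1ℚ → AtLevel n m p
  section-by-level q p (equal _) refl _ _ α close = q , α , refl , close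
  section-by-level q p (less ℓ zero) level≡ _ m≤2ⁿ α close =
    section-above q p α (cong suc (trans level≡ (sym (ℕ.+-identityʳ ℓ)))) m≤2ⁿ
                  (adjacent-level (level-gap< ℓ 0) close)
  section-by-level q p (greater m zero) level≡ 1≤m _ α close =
    section-below q p α (trans (ℕ.suc-injective level≡) (ℕ.+-identityʳ m)) 1≤m
                  (adjacent-level (level-gap> m 0) close)
  section-by-level q p (less ℓ (suc k)) _ _ _ _ close =
    ⊥-elim (distant-level (suc (ℓ ℕ.+ suc k)) q p k (level-gap< ℓ (suc k)) close)
  section-by-level q p (greater m (suc k)) _ _ _ _ close =
    ⊥-elim (distant-level m q p k (level-gap> m (suc k)) close)

  section-at-level : ∀ {n m} q p → 1 ℕ.≤ m → m ℕ.≤ 2 ℕ.^ n → Address n q →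
                     boardDistance m q p ≤ 1ℚ → AtLevel n m p
  section-at-level {m = m} q p = section-by-level q p (compare (suc (level q)) m) refl

open import Data.Nat using (ℕ; zero; suc; _∸_; _<_; _≤_; _^_)
open import Data.Nat.Properties using (m+[n∸m]≡n)
open import Data.Product using (∃-syntax; _,_)
open import Function.Bundles using (Equivalence)
open Addresses using (P-position-address; address-P-position)
open Octahedra using (Any-S⁺; Any-S⁻)
open Section using (similarity; octahedron-section; cell-section; section-at-level)

theorem6 : (n m : ℕ) → 0 < m → m ≤ 2 ^ n →
    ∃[ f ] MapsOnto f (InR m) (InH n m)
theorem6 n m 0<m m≤2ⁿ = similarity n m , λ p → R⇒H p , H⇒R p
  where
  R⇒H : ∀ p → InR m p → InH n m (apply (similarity n m) p)
  R⇒H p (zero  , _     , (() , _) , _)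
  R⇒H p (suc _ , zero  , (_ , _ , () , _) , _)
  R⇒H p (suc a , suc c , inP@(_ , i≤m , _) , inCell) =
    let α = P-position-address {n} {m} {a} {c} inP m≤2ⁿ
    in  Any-S⁺ α (Equivalence.from (octahedron-section n m (a , m ∸ suc a , c , m ∸ suc c) p)
                   (Equivalence.from (cell-section α (m+[n∸m]≡n i≤m) p) inCell))

  H⇒R : ∀ p → InH n m (apply (similarity n m) p) → InR m p
  H⇒R p inH =
    let q , α , inOct = Any-S⁻ n inH
        (a , b , c , d) , α′ , level≡ , close =
          section-at-level q p 0<m m≤2ⁿ α (Equivalence.to (octahedron-section n m q p) inOct)
    in  suc a , suc c , address-P-position α′ level≡ , Equivalence.to (cell-section α′ level≡ p) close
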